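{- Let $(D,I,J,R)$ be a string data bistructure over a totally ordered alphabet $A$. Then the products $\star_I$ and $\star_J$ on $D$ are associative, the relation $d\star_I d'=d'\star_J d$ holds for all $d,d'\in D$, and the structure monoids $\mathbf{M}(D,I)=(D,\star_I)$ and $\mathbf{M}(D,J)=(D,\star_J)$ are anti-isomorphic.
   Context: Let $A$ be a totally ordered alphabet and $A^\ast$ the free monoid on $A$, with empty word $\lambda$. A reading of words on $A$ is a map $\ell:A^\ast\to A^\ast$ sending each word $x_1\ldots x_k$ to $x_{\sigma(1)}\ldots x_{\sigma(k)}$ for a permutation $\sigma$ of $\{1,\ldots,k\}$; $\ell_{LR}$ is the identity and $\ell_{RL}$ sends $x_1\ldots x_k$ to $x_k\ldots x_1$. A string data structure over $A$ is a quadruple $(D,\ell,I,R)$ where $D$ is a set with a distinguished element $\emptyset$, $\ell$ is a reading, and $R:D\to A^\ast$, $I:D\times A\to D$ are maps such that: (i) $R(I(\emptyset,x))=x$ for all $x\in A$; (ii) $I_\ell(\emptyset,R(d))=d$ for all $d$, where $I_\ell(d,\lambda)=d$ and $I_\ell(d,u)=I(\ldots I(I(d,x_1),x_2)\ldots,x_k)$ with $x_1\ldots x_k=\ell(u)$; (iii) $I_\ell(\emptyset,-):A^\ast\to D$ is surjective; (iv) $R$ is injective and $R(\emptyset)=\lambda$. The associated product is $d\star_I d':=I_\ell(d,R(d'))$. A string data bistructure over $A$ is a quadruple $(D,I,J,R)$ such that $(D,\ell_{LR},I,R)$ and $(D,\ell_{RL},J,R)$ are string data structures over $A$ (so $d\star_I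 d'$ inserts the letters of $R(d')$ into $d$ with $I$ from first to last, and $d\star_J d'$ inserts the letters of $R(d')$ into $d$ with $J$ from last to first), and such that $I$ and $J$ commute: $J(I(d,x),y)=I(J(d,y),x)$ for all $d\in D$ and $x,y\in A$. -}

module Defs where

open import Data.List using (List; []; _∷_; [_]; foldl; length; lookup; tabulate; reverse)
open import Data.Fin.Permutation using (Permutation′; _⟨$⟩ʳ_)
open import Data.Product using (Σ; ∃; _×_)
open import Function using (id)
open import Function.Definitions using (Injective)
open import Relation.Binary.PropositionalEquality using (_≡_)

IsReading : {A : Set} → (List A → List A) → Set
IsReading {A} ℓ = (u : List A) →
  Σ (Permutation′ (length u)) λ σ → ℓ u ≡ tabulate (λ i → lookup u (σ ⟨$⟩ʳ i))

ℓLR : {A : Set} → List A → List A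
ℓLR = id

ℓRL : {A : Set} → List A → List A
ℓRL = reverse

insertℓ : {A D : Set} → (List A → List A) → (D → A → D) → D → List A → D
insertℓ ℓ I d u = foldl I d (ℓ u)

record IsStringDataStructure {A D : Set} (∅ : D) (ℓ : List A → List A)
         (I : D → A → D) (R : D → List A) : Set where
  field
    isReading   : IsReading ℓ
    R-I-∅       : ∀ (x : A) → R (I ∅ x) ≡ [ x ]
    Iℓ-R        : ∀ (d : D) → insertℓ ℓ I ∅ (R d) ≡ d
    Iℓ-surj     : ∀ (d : D) → ∃ λ (u : List A) → insertℓ ℓ I ∅ u ≡ d
    R-injective : Injective _≡_ _≡_ R
    R-∅         : R ∅ ≡ []

product : {A D : Set} → (List A → List A) → (D → A → D) → (D → List A) → D → D → D
product ℓ I R d d' = insertℓ ℓ I d (R d')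

record IsStringDataBistructure {A D : Set} (∅ : D)
         (I J : D → A → D) (R : D → List A) : Set where
  field
    I-structure : IsStringDataStructure ∅ ℓLR I R
    J-structure : IsStringDataStructure ∅ ℓRL J R
    commute     : ∀ (d : D) (x y : A) → J (I d x) y ≡ I (J d y) x

-- Reading a word d backwards with J from ∅ rebuilds d, and every J-step commutes
-- with every I-step. Hence inserting R(d') into d with I is the same as inserting
-- R(d) into d' with J: d ⋆I d' ≡ d' ⋆J d. Associativity of ⋆I follows by moving
-- the J-insertion of R(d) past the I-insertions of R(d''), that of ⋆J by
-- transport along this identity, and the identity map is the anti-isomorphism.
module Submission where

open import Defs
open import Data.List using (List; []; _∷_; foldl; reverse)
open import Data.Product using (Σ; _×_; _,_)
open import Function.Bundles using (_⤖_; Bijection)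
open import Function.Construct.Identity using (⤖-id)
open import Relation.Binary.Structures using (IsStrictTotalOrder)
open import Relation.Binary.PropositionalEquality using (_≡_; refl; sym; cong; module ≡-Reasoning)

module _ {A D : Set} (I J : D → A → D)
         (commute : ∀ (d : D) (x y : A) → J (I d x) y ≡ I (J d y) x) where

  foldl-J-I : ∀ (d : D) x v → foldl J (I d x) v ≡ I (foldl J d v) x
  foldl-J-I d x []      = refl
  foldl-J-I d x (y ∷ v) = begin
    foldl J (J (I d x) y) v  ≡⟨ cong (λ e → foldl J e v) (commute d x y) ⟩
    foldl J (I (J d y) x) v  ≡⟨ foldl-J-I (J d y) x v ⟩
    I (foldl J (J d y) v) x  ∎
    where open ≡-Reasoning

  foldl-I-foldl-J : ∀ (d : D) v w → foldl I (foldl J d v) w ≡ foldl J (foldl I d w) v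
  foldl-I-foldl-J d v []      = refl
  foldl-I-foldl-J d v (x ∷ w) = begin
    foldl I (I (foldl J d v) x) w  ≡⟨ cong (λ e → foldl I e w) (sym (foldl-J-I d x v)) ⟩
    foldl I (foldl J (I d x) v) w  ≡⟨ foldl-I-foldl-J (I d x) v w ⟩
    foldl J (foldl I (I d x) w) v  ∎
    where open ≡-Reasoning

module BistructureProducts {A D : Set} {∅ : D} {I J : D → A → D} {R : D → List A}
                           (bi : IsStringDataBistructure ∅ I J R) where

  open IsStringDataBistructure bi
  open IsStringDataStructure I-structure using () renaming (Iℓ-R to I-rebuilds)
  open IsStringDataStructure J-structure using () renaming (Iℓ-R to J-rebuilds)
  open ≡-Reasoning

  infixl 7 _⋆I_ _⋆J_

  _⋆I_ : D → D → D
  _⋆I_ = product ℓLR I R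

  _⋆J_ : D → D → D
  _⋆J_ = product ℓRL J R

  ⋆I≡flip-⋆J : ∀ d d' → d ⋆I d' ≡ d' ⋆J d
  ⋆I≡flip-⋆J d d' = begin
    foldl I d (R d')                         ≡⟨ cong (λ e → foldl I e (R d')) (sym (J-rebuilds d)) ⟩
    foldl I (foldl J ∅ (reverse (R d))) (R d') ≡⟨ foldl-I-foldl-J I J commute ∅ (reverse (R d)) (R d') ⟩
    foldl J (foldl I ∅ (R d')) (reverse (R d)) ≡⟨ cong (λ e → foldl J e (reverse (R d))) (I-rebuilds d') ⟩
    foldl J d' (reverse (R d))               ∎

  ⋆I-assoc : ∀ d d' d'' → (d ⋆I d') ⋆I d'' ≡ d ⋆I (d' ⋆I d'')
  ⋆I-assoc d d' d'' = begin
    foldl I (d ⋆I d') (R d'')                        ≡⟨ cong (λ e → foldl I e (R d'')) (⋆I≡flip-⋆J d d') ⟩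
    foldl I (foldl J d' (reverse (R d))) (R d'')     ≡⟨ foldl-I-foldl-J I J commute d' (reverse (R d)) (R d'') ⟩
    foldl J (d' ⋆I d'') (reverse (R d))              ≡⟨ sym (⋆I≡flip-⋆J d (d' ⋆I d'')) ⟩
    d ⋆I (d' ⋆I d'')                                 ∎

  ⋆J-assoc : ∀ d d' d'' → (d ⋆J d') ⋆J d'' ≡ d ⋆J (d' ⋆J d'')
  ⋆J-assoc d d' d'' = begin
    (d ⋆J d') ⋆J d''   ≡⟨ sym (⋆I≡flip-⋆J d'' (d ⋆J d')) ⟩
    d'' ⋆I (d ⋆J d')   ≡⟨ cong (d'' ⋆I_) (sym (⋆I≡flip-⋆J d' d)) ⟩
    d'' ⋆I (d' ⋆I d)   ≡⟨ sym (⋆I-assoc d'' d' d) ⟩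
    (d'' ⋆I d') ⋆I d   ≡⟨ ⋆I≡flip-⋆J (d'' ⋆I d') d ⟩
    d ⋆J (d'' ⋆I d')   ≡⟨ cong (d ⋆J_) (⋆I≡flip-⋆J d'' d') ⟩
    d ⋆J (d' ⋆J d'')   ∎

mainTheorem4 : (A : Set) (_<_ : A → A → Set) → IsStrictTotalOrder _≡_ _<_ →
    (D : Set) (∅ : D) (I J : D → A → D) (R : D → List A) →
    IsStringDataBistructure ∅ I J R →
    ((d d' d'' : D) → product ℓLR I R (product ℓLR I R d d') d''
                        ≡ product ℓLR I R d (product ℓLR I R d' d''))
    × ((d d' d'' : D) → product ℓRL J R (product ℓRL J R d d') d''
                        ≡ product ℓRL J R d (product ℓRL J R d' d''))
    × ((d d' : D) → product ℓLR I R d d' ≡ product ℓRL J R d' d)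
    × Σ (D ⤖ D) (λ f →
        (Bijection.to f ∅ ≡ ∅)
        × ((d d' : D) → Bijection.to f (product ℓLR I R d d')
                          ≡ product ℓRL J R (Bijection.to f d') (Bijection.to f d)))
mainTheorem4 A _<_ _ D ∅ I J R bi =
  ⋆I-assoc , ⋆J-assoc , ⋆I≡flip-⋆J , ⤖-id D , refl , ⋆I≡flip-⋆J
  where open BistructureProducts bi
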